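{- Let $v,k,l$ be positive integers. As a function of the integer $e$, $\mathrm{Diff}(v,e)=S(v,e)-C(v,e)$ is linear on the interval $\max\{\binom k2,\binom v2-\binom{l+1}2\}\le e\le\min\{\binom{k+1}2,\binom v2-\binom l2\}$, with slope $-\frac14\left(1-(2k-3)^2-(2l-3)^2+(2v-5)^2\right)$.
   Context: For $0\le e\le\binom v2$ write $e=\binom{k+1}2-j$ with integers $1\le j\le k$; the quasi-complete graph on $v$ vertices with $e$ edges consists of a complete graph on vertices $1,\dots,k$, a vertex $k+1$ adjacent to vertices $1,\dots,k-j$, and isolated vertices; $C(v,e)$ is its sum of squared degrees, $C(v,e)=j(k-1)^2+(k-j)k^2+(k-j)^2$. The quasi-star graph on $v$ vertices with $e$ edges is the complement of the quasi-complete graph with $v$ vertices and $\binom v2-e$ edges; $S(v,e)$ is its sum of squared degrees. -}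

module Defs where

open import Data.Nat using (ℕ; zero; suc; _+_; _*_; _∸_; _^_; _<ᵇ_; _≤ᵇ_; _≡ᵇ_)
open import Data.Nat.Combinatorics using (_C_)
open import Data.Bool using (if_then_else_)
open import Data.List using (List; map; upTo)
open import Data.Nat.ListAction using (sum)
open import Data.Integer as ℤ using (ℤ; +_)
import Data.Nat
import Data.Product

findK : ℕ → ℕ → ℕ → ℕ
findK zero    k e = k
findK (suc f) k e = if e <ᵇ (suc k C 2) then k else findK f (suc k) e

-- The unique k ≥ 1 with e = binom(k+1,2) - j, 1 ≤ j ≤ k,
-- i.e. the least k ≥ 1 with e < binom(k+1,2)  (fuel e+1 suffices).
qcK : ℕ → ℕ
qcK e = findK (suc e) 1 e

qcJ : ℕ → ℕ
qcJ e = (suc (qcK e) C 2) ∸ e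

Cq : ℕ → ℕ → ℕ
Cq v e = let k = qcK e ; j = qcJ e in
  j * (k ∸ 1) ^ 2 + (k ∸ j) * k ^ 2 + (k ∸ j) ^ 2

-- degree of vertex i (1-based, 1 ≤ i ≤ v) in the quasi-complete graph
-- with e edges: vertices 1..k-j have degree k, vertices k-j+1..k have
-- degree k-1, vertex k+1 has degree k-j, others are isolated.
qcDeg : ℕ → ℕ → ℕ
qcDeg e i = let k = qcK e ; j = qcJ e in
  if i ≤ᵇ (k ∸ j) then k
  else if i ≤ᵇ k then k ∸ 1
  else if i ≡ᵇ suc k then k ∸ j
  else 0

-- S(v,e): sum of squared degrees of the quasi-star graph, the complement
-- (on v vertices) of the quasi-complete graph with binom(v,2) - e edges;
-- a vertex of degree d has degree v-1-d in the complement.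
Sq : ℕ → ℕ → ℕ
Sq v e = sum (map (λ i → ((v ∸ 1) ∸ qcDeg ((v C 2) ∸ e) (suc i)) ^ 2) (upTo v))

Diff : ℕ → ℕ → ℤ
Diff v e = + Sq v e ℤ.- + Cq v e

InInterval : ℕ → ℕ → ℕ → ℕ → Set
InInterval v k l e =
  (k C 2 Data.Nat.≤ e) Data.Product.× (v C 2 Data.Nat.≤ e + (suc l C 2))
  Data.Product.× (e Data.Nat.≤ suc k C 2) Data.Product.× (e + l C 2 Data.Nat.≤ v C 2)

module Submission where

-- Write T n = n C 2.  If T k ≤ e ≤ T (k+1), the quasi-complete graph with e
-- edges has parameters (k, T(k+1) - e), except at the right end point, where
-- they jump to (k+1, k+1); both descriptions give the same value, so
-- C(v,e) = Cpoly k (T(k+1) - e) for a fixed polynomial Cpoly.  Dually the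
-- quasi-star graph is the complement of the quasi-complete graph with
-- e₂ = T v - e edges, T l ≤ e₂ ≤ T (l+1); listing its complement degrees
-- class by class gives S(v,e) = Spoly v l (T(l+1) - e₂).  So Diff(v,e) is an
-- explicit polynomial in e whose quadratic terms cancel; once 2·T n = n(n-1)
-- is substituted, four times a difference of two values is the claimed slope
-- times (e′ - e).

open import Defs
open import Data.Nat.Combinatorics using (_C_)
open import Relation.Binary.PropositionalEquality
open ≡-Reasoning

module Combinatorics where
  open import Data.Nat
  open import Data.Nat.Properties
  open import Data.Nat.Combinatorics using (nC1≡n; nCk+nC[k+1]≡[n+1]C[k+1])
  open import Data.Nat.Tactic.RingSolver using (solve-∀)
  open import Data.Bool using (true; false; T; if_then_else_)
  open import Data.Empty using (⊥-elim)
  open import Data.List using (applyUpTo)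
  open import Data.List.Properties using (map-upTo)
  open import Data.Nat.ListAction using (sum)
  open import Relation.Nullary using (¬_)

  C2-suc : ∀ n → suc n C 2 ≡ n + n C 2
  C2-suc n = trans (sym (nCk+nC[k+1]≡[n+1]C[k+1] n 1)) (cong (_+ n C 2) (nC1≡n n))

  two-C2 : ∀ n → 2 * (suc n C 2) ≡ suc n * n
  two-C2 zero    = refl
  two-C2 (suc n) = begin
    2 * (suc (suc n) C 2)       ≡⟨ cong (2 *_) (C2-suc (suc n)) ⟩
    2 * (suc n + suc n C 2)     ≡⟨ *-distribˡ-+ 2 (suc n) (suc n C 2) ⟩
    2 * suc n + 2 * (suc n C 2) ≡⟨ cong (2 * suc n +_) (two-C2 n) ⟩
    2 * suc n + suc n * n       ≡⟨ regroup n ⟩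
    suc (suc n) * suc n         ∎
    where regroup : ∀ n → 2 * suc n + suc n * n ≡ suc (suc n) * suc n
          regroup = solve-∀

  C2-mono-≤ : ∀ {m n} → m ≤ n → m C 2 ≤ n C 2
  C2-mono-≤ {m} {n} m≤n = subst (λ n → m C 2 ≤ n C 2) (m+[n∸m]≡n m≤n) (grow m (n ∸ m))
    where grow : ∀ m d → m C 2 ≤ (m + d) C 2
          grow m zero    = ≤-reflexive (cong (_C 2) (sym (+-identityʳ m)))
          grow m (suc d) = ≤-trans (grow m d)
            (≤-trans (m≤n+m _ (m + d)) (≤-reflexive (trans (sym (C2-suc (m + d))) (cong (_C 2) (sym (+-suc m d))))))

  C2-< : ∀ {n} → 1 ≤ n → n C 2 < suc n C 2
  C2-< {n} 1≤n = ≤-trans (+-monoˡ-≤ (n C 2) 1≤n) (≤-reflexive (sym (C2-suc n)))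

  C2-cancel-≤ : ∀ {m n} → 1 ≤ n → m C 2 ≤ n C 2 → m ≤ n
  C2-cancel-≤ 1≤n le = ≮⇒≥ (λ n<m → <⇒≱ (C2-< 1≤n) (≤-trans (C2-mono-≤ n<m) le))

  C2-gap : ∀ k → suc k C 2 ∸ k C 2 ≡ k
  C2-gap k = trans (cong (_∸ k C 2) (C2-suc k)) (m+n∸n≡m k (k C 2))

  gap-bound : ∀ {k e} → k C 2 ≤ e → suc k C 2 ∸ e ≤ k
  gap-bound {k} lo = ≤-trans (∸-monoʳ-≤ (suc k C 2) lo) (≤-reflexive (C2-gap k))

  if-T : ∀ {A : Set} {b} {x y : A} → T b → (if b then x else y) ≡ x
  if-T {b = true} _ = refl

  if-¬T : ∀ {A : Set} {b} {x y : A} → ¬ T b → (if b then x else y) ≡ y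
  if-¬T {b = true}  ¬t = ⊥-elim (¬t _)
  if-¬T {b = false} _  = refl

  -- Started at k with enough fuel, findK stops exactly at the K = k + d with
  -- T K ≤ e < T (K+1): every earlier candidate K' satisfies T (K'+1) ≤ T K ≤ e.
  findK-lands : ∀ d f k e → (k + d) C 2 ≤ e → e < suc (k + d) C 2 → findK (d + suc f) k e ≡ k + d
  findK-lands zero f k e _ e< =
    trans (if-T (<⇒<ᵇ (subst (λ K → e < suc K C 2) (+-identityʳ k) e<))) (sym (+-identityʳ k))
  findK-lands (suc d) f k e lo e< = begin
    findK (suc d + suc f) k e    ≡⟨ if-¬T (λ t → <⇒≱ (<ᵇ⇒< e _ t) passed) ⟩
    findK (d + suc f) (suc k) e  ≡⟨ findK-lands d f (suc k) e (subst (λ K → K C 2 ≤ e) (+-suc k d) lo)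
                                                              (subst (λ K → e < suc K C 2) (+-suc k d) e<) ⟩
    suc k + d                    ≡⟨ sym (+-suc k d) ⟩
    k + suc d                    ∎
    where passed : suc k C 2 ≤ e
          passed = ≤-trans (C2-mono-≤ (≤-trans (s≤s (m≤m+n k d)) (≤-reflexive (sym (+-suc k d))))) lo

  qcK-unique : ∀ {K e} → 1 ≤ K → K C 2 ≤ e → e < suc K C 2 → qcK e ≡ K
  qcK-unique {suc d} {e} _ lo e< = trans (cong (λ f → findK f 1 e) fuel) (findK-lands d (e ∸ d) 1 e lo e<)
    where d≤e : d ≤ e
          d≤e = ≤-trans (≤-trans (m≤m+n d (d C 2)) (≤-reflexive (sym (C2-suc d)))) lo
          fuel : suc e ≡ d + suc (e ∸ d)
          fuel = trans (cong suc (sym (m+[n∸m]≡n d≤e))) (sym (+-suc d (e ∸ d)))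

  qcK-boundary : ∀ k → qcK (suc k C 2) ≡ suc k
  qcK-boundary k = qcK-unique (s≤s z≤n) ≤-refl (C2-< {suc k} (s≤s z≤n))

  qcJ-boundary : ∀ k → qcJ (suc k C 2) ≡ suc k
  qcJ-boundary k = trans (cong (λ K → suc K C 2 ∸ suc k C 2) (qcK-boundary k)) (C2-gap (suc k))

  deg : ℕ → ℕ → ℕ → ℕ
  deg K J i = if i ≤ᵇ (K ∸ J) then K
    else if i ≤ᵇ K then K ∸ 1
    else if i ≡ᵇ suc K then K ∸ J
    else 0

  not-≤ᵇ : ∀ {m n} → n < m → ¬ T (m ≤ᵇ n)
  not-≤ᵇ n<m t = <⇒≱ n<m (≤ᵇ⇒≤ _ _ t)

  deg-full : ∀ K J i → i ≤ K ∸ J → deg K J i ≡ K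
  deg-full K J i i≤ = if-T (≤⇒≤ᵇ i≤)

  deg-partial : ∀ K J i → K ∸ J < i → i ≤ K → deg K J i ≡ K ∸ 1
  deg-partial K J i <i i≤ = trans (if-¬T (not-≤ᵇ <i)) (if-T (≤⇒≤ᵇ i≤))

  deg-apex : ∀ K J → deg K J (suc K) ≡ K ∸ J
  deg-apex K J = trans (if-¬T (not-≤ᵇ (s≤s (m∸n≤m K J))))
                (trans (if-¬T (not-≤ᵇ (n<1+n K))) (if-T (≡⇒≡ᵇ (suc K) (suc K) refl)))

  deg-isolated : ∀ K J i → suc (suc K) ≤ i → deg K J i ≡ 0
  deg-isolated K J i le =
    trans (if-¬T (not-≤ᵇ (≤-trans (s≤s (m∸n≤m K J)) (≤-trans (n≤1+n _) le))))
    (trans (if-¬T (not-≤ᵇ (≤-trans (n≤1+n _) le)))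
           (if-¬T (λ t → <⇒≢ le (sym (≡ᵇ⇒≡ i (suc K) t)))))

  complementSum : ℕ → ℕ → ℕ → ℕ
  complementSum v K J = sum (applyUpTo (λ i → ((v ∸ 1) ∸ deg K J (suc i)) ^ 2) v)

  Sq-complementSum : ∀ v e → Sq v e ≡ complementSum v (qcK (v C 2 ∸ e)) (qcJ (v C 2 ∸ e))
  Sq-complementSum v e = cong sum (map-upTo _ v)

  sum-split : ∀ m n (f : ℕ → ℕ) →
              sum (applyUpTo f (m + n)) ≡ sum (applyUpTo f m) + sum (applyUpTo (λ i → f (m + i)) n)
  sum-split zero    n f = refl
  sum-split (suc m) n f = trans (cong (f 0 +_) (sum-split m n (λ i → f (suc i)))) (sym (+-assoc (f 0) _ _))

  sum-const : ∀ n (f : ℕ → ℕ) {c} → (∀ i → i < n → f i ≡ c) → sum (applyUpTo f n) ≡ n * c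
  sum-const zero    f const = refl
  sum-const (suc n) f const = cong₂ _+_ (const 0 z<s) (sum-const n (λ i → f (suc i)) (λ i i< → const (suc i) (s<s i<)))

  -- For K = a + J < v = K + 1 + r the complement degrees are r (a full vertices),
  -- r+1 (J partial vertices), J+r (the apex) and K+r (r isolated vertices).
  complementSum-quasi : ∀ a J r →
    complementSum (a + J + suc r) (a + J) J ≡ a * r ^ 2 + J * suc r ^ 2 + ((J + r) ^ 2 + r * (a + J + r) ^ 2)
  complementSum-quasi a J r = begin
    sum (applyUpTo co² (K + suc r))                                       ≡⟨ sum-split K (suc r) co² ⟩
    sum (applyUpTo co² (a + J)) + sum (applyUpTo (λ i → co² (K + i)) (suc r))
                                                                        ≡⟨ cong (_+ sum (applyUpTo (λ i → co² (K + i)) (suc r))) (sum-split a J co²) ⟩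
    sum (applyUpTo co² a) + sum (applyUpTo (λ i → co² (a + i)) J) + (co² (K + 0) + sum (applyUpTo (λ i → co² (K + suc i)) r))
      ≡⟨ cong₂ _+_ (cong₂ _+_ (sum-const a co² full) (sum-const J _ partial))
                   (cong₂ _+_ (trans (cong co² (+-identityʳ K)) (cong (_^ 2) apex)) (sum-const r _ isolated)) ⟩
    a * r ^ 2 + J * suc r ^ 2 + ((J + r) ^ 2 + r * (K + r) ^ 2)           ∎
    where
    K : ℕ
    K = a + J
    co : ℕ → ℕ
    co i = (K + suc r ∸ 1) ∸ deg K J (suc i)
    co² : ℕ → ℕ
    co² i = co i ^ 2
    top : K + suc r ∸ 1 ≡ K + r
    top = cong (_∸ 1) (+-suc K r)
    full : ∀ i → i < a → co² i ≡ r ^ 2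
    full i i<a = cong (_^ 2) (begin
      (K + suc r ∸ 1) ∸ deg K J (suc i) ≡⟨ cong₂ _∸_ top (deg-full K J (suc i) (subst (suc i ≤_) (sym (m+n∸n≡m a J)) i<a)) ⟩
      K + r ∸ K                        ≡⟨ m+n∸m≡n K r ⟩
      r                                ∎)
    partial : ∀ i → i < J → co² (a + i) ≡ suc r ^ 2
    partial i i<J = cong (_^ 2) (begin
      (K + suc r ∸ 1) ∸ deg K J (suc (a + i))
        ≡⟨ cong₂ _∸_ top (deg-partial K J (suc (a + i)) (subst (_< suc (a + i)) (sym (m+n∸n≡m a J)) (s≤s (m≤m+n a i)))
                                                       (≤-trans (≤-reflexive (sym (+-suc a i))) (+-monoʳ-≤ a i<J))) ⟩
      K + r ∸ (K ∸ 1)  ≡⟨ K+r∸[K∸1] (≤-trans (s≤s z≤n) (≤-trans i<J (m≤n+m J a))) ⟩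
      suc r            ∎)
      where K+r∸[K∸1] : ∀ {K} → 1 ≤ K → K + r ∸ (K ∸ 1) ≡ suc r
            K+r∸[K∸1] {suc K} _ = trans (cong (_∸ K) (sym (+-suc K r))) (m+n∸m≡n K (suc r))
    apex : co K ≡ J + r
    apex = begin
      (K + suc r ∸ 1) ∸ deg K J (suc K) ≡⟨ cong₂ _∸_ top (trans (deg-apex K J) (m+n∸n≡m a J)) ⟩
      a + J + r ∸ a                     ≡⟨ cong (_∸ a) (+-assoc a J r) ⟩
      a + (J + r) ∸ a                   ≡⟨ m+n∸m≡n a (J + r) ⟩
      J + r                             ∎
    isolated : ∀ i → i < r → co² (K + suc i) ≡ (K + r) ^ 2
    isolated i _ = cong (_^ 2) (cong₂ _∸_ top (deg-isolated K J _ (s≤s (≤-trans (s≤s (m≤m+n K i)) (≤-reflexive (sym (+-suc K i)))))))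

  complementSum-complete : ∀ v → complementSum v v v ≡ 0
  complementSum-complete v = trans (sum-const v _ no-edges) (*-zeroʳ v)
    where no-edges : ∀ i → i < v → ((v ∸ 1) ∸ deg v v (suc i)) ^ 2 ≡ 0
          no-edges i i<v = cong (_^ 2)
            (trans (cong ((v ∸ 1) ∸_) (deg-partial v v (suc i) (subst (_< suc i) (sym (n∸n≡0 v)) z<s) i<v))
                   (n∸n≡0 (v ∸ 1)))

open Combinatorics
open import Data.Nat as ℕ using (ℕ; suc; _∸_; _≤_; s≤s; z≤n)
import Data.Nat.Properties as ℕP
open import Data.Integer as ℤ using (ℤ; +_; -_; _+_; _-_; _*_; _^_)
open import Data.Integer.Properties using (pos-*; m-n≡m⊖n; ⊖-≥; +-inverseʳ)
open import Data.Integer.Tactic.RingSolver using (solve-∀)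
open import Data.Sum using (inj₁; inj₂)
open import Data.Product using (_,_)

Cpoly : ℤ → ℤ → ℤ
Cpoly k j = j * (k - + 1) ^ 2 + (k - j) * k ^ 2 + (k - j) ^ 2

Spoly : ℤ → ℤ → ℤ → ℤ
Spoly v l j = (l - j) * (v - + 1 - l) ^ 2 + j * (v - l) ^ 2 + (v - + 1 - l + j) ^ 2 + (v - + 1 - l) * (v - + 1) ^ 2

pos-∸ : ∀ {m n} → n ≤ m → + (m ∸ n) ≡ + m - + n
pos-∸ {m} {n} n≤m = sym (trans (m-n≡m⊖n m n) (⊖-≥ n≤m))

pos-^2 : ∀ n → + (n ℕ.^ 2) ≡ (+ n) ^ 2
pos-^2 n = trans (pos-* n (n ℕ.* 1)) (cong (+ n *_) (pos-* n 1))

pos-*-^2 : ∀ m n → + (m ℕ.* n ℕ.^ 2) ≡ + m * (+ n) ^ 2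
pos-*-^2 m n = trans (pos-* m (n ℕ.^ 2)) (cong (+ m *_) (pos-^2 n))

Cq-Cpoly : ∀ v e {K J} → qcK e ≡ K → qcJ e ≡ J → 1 ≤ K → J ≤ K → + Cq v e ≡ Cpoly (+ K) (+ J)
Cq-Cpoly v e {K} {J} refl refl 1≤K J≤K =
  cong₂ _+_ (cong₂ _+_ (trans (pos-*-^2 J (K ∸ 1)) (cong (λ x → + J * x ^ 2) (pos-∸ 1≤K)))
                           (trans (pos-*-^2 (K ∸ J) K) (cong (λ x → x * (+ K) ^ 2) (pos-∸ J≤K))))
              (trans (pos-^2 (K ∸ J)) (cong (_^ 2) (pos-∸ J≤K)))

-- The ring solver does not unfold definitions, so the ring identities below
-- restate Cpoly and Spoly inline (x ^ 2 is by definition x * (x * + 1)).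

-- Cpoly takes the same value on the two descriptions (k+1, k+1) and (k, 0) of K_{k+1}.
Cpoly-boundary : ∀ k t → Cpoly (+ 1 + k) (+ 1 + k) ≡ Cpoly k (t - t)
Cpoly-boundary = expanded
  where
  expanded : ∀ k t →
    let sq : ℤ → ℤ
        sq x = x * (x * + 1)
        C : ℤ → ℤ → ℤ
        C k j = j * sq (k - + 1) + (k - j) * sq k + sq (k - j)
    in C (+ 1 + k) (+ 1 + k) ≡ C k (t - t)
  expanded = solve-∀

Cq-formula : ∀ v k e → 1 ≤ k → k C 2 ≤ e → e ≤ suc k C 2 → + Cq v e ≡ Cpoly (+ k) (+ (suc k C 2) - + e)
Cq-formula v k e 1≤k lo hi with ℕP.m≤n⇒m<n∨m≡n hi
... | inj₁ e< = trans (Cq-Cpoly v e K≡k (cong (λ K → suc K C 2 ∸ e) K≡k) 1≤k (gap-bound lo))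
                      (cong (Cpoly (+ k)) (pos-∸ hi))
  where K≡k : qcK e ≡ k
        K≡k = qcK-unique 1≤k lo e<
... | inj₂ refl = trans (Cq-Cpoly v e (qcK-boundary k) (qcJ-boundary k) (s≤s z≤n) ℕP.≤-refl)
                        (Cpoly-boundary (+ k) (+ e))

-- Spoly takes the same value on the descriptions (l+1, l+1) and (l, 0) of K_{l+1}.
Spoly-boundary : ∀ v l t → Spoly v (+ 1 + l) (+ 1 + l) ≡ Spoly v l (t - t)
Spoly-boundary = expanded
  where
  expanded : ∀ v l t →
    let sq : ℤ → ℤ
        sq x = x * (x * + 1)
        S : ℤ → ℤ → ℤ → ℤ
        S v l j = (l - j) * sq (v - + 1 - l) + j * sq (v - l) + sq (v - + 1 - l + j) + (v - + 1 - l) * sq (v - + 1)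
    in S v (+ 1 + l) (+ 1 + l) ≡ S v l (t - t)
  expanded = solve-∀

-- The complement of K_v is edgeless.
Spoly-complete : ∀ v → Spoly v v v ≡ + 0
Spoly-complete = expanded
  where
  expanded : ∀ v →
    let sq : ℤ → ℤ
        sq x = x * (x * + 1)
        S : ℤ → ℤ → ℤ → ℤ
        S v l j = (l - j) * sq (v - + 1 - l) + j * sq (v - l) + sq (v - + 1 - l + j) + (v - + 1 - l) * sq (v - + 1)
    in S v v v ≡ + 0
  expanded = solve-∀

Spoly-quasi : ∀ a J r →
  a * r ^ 2 + J * (+ 1 + r) ^ 2 + ((J + r) ^ 2 + r * (a + J + r) ^ 2) ≡ Spoly (a + J + (+ 1 + r)) (a + J) J
Spoly-quasi = expanded
  where
  expanded : ∀ a J r →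
    let sq : ℤ → ℤ
        sq x = x * (x * + 1)
        S : ℤ → ℤ → ℤ → ℤ
        S v l j = (l - j) * sq (v - + 1 - l) + j * sq (v - l) + sq (v - + 1 - l + j) + (v - + 1 - l) * sq (v - + 1)
    in a * sq r + J * sq (+ 1 + r) + (sq (J + r) + r * sq (a + J + r)) ≡ S (a + J + (+ 1 + r)) (a + J) J
  expanded = solve-∀

complementSum-quasi-ℤ : ∀ a J r →
  + complementSum (a ℕ.+ J ℕ.+ suc r) (a ℕ.+ J) J ≡ Spoly (+ (a ℕ.+ J ℕ.+ suc r)) (+ (a ℕ.+ J)) (+ J)
complementSum-quasi-ℤ a J r = begin
  + complementSum (a ℕ.+ J ℕ.+ suc r) (a ℕ.+ J) J
    ≡⟨ cong +_ (complementSum-quasi a J r) ⟩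
  + (a ℕ.* r ℕ.^ 2 ℕ.+ J ℕ.* suc r ℕ.^ 2 ℕ.+ ((J ℕ.+ r) ℕ.^ 2 ℕ.+ r ℕ.* (a ℕ.+ J ℕ.+ r) ℕ.^ 2))
    ≡⟨ cong₂ _+_ (cong₂ _+_ (pos-*-^2 a r) (pos-*-^2 J (suc r))) (cong₂ _+_ (pos-^2 (J ℕ.+ r)) (pos-*-^2 r (a ℕ.+ J ℕ.+ r))) ⟩
  + a * (+ r) ^ 2 + + J * (+ 1 + + r) ^ 2 + ((+ J + + r) ^ 2 + + r * (+ a + + J + + r) ^ 2)
    ≡⟨ Spoly-quasi (+ a) (+ J) (+ r) ⟩
  Spoly (+ (a ℕ.+ J ℕ.+ suc r)) (+ (a ℕ.+ J)) (+ J) ∎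

-- Square sum of the complement of a quasi-complete graph with parameters
-- (K, J) on v ≥ K vertices; when K = v the graph must be K_v.
complementSum-ℤ : ∀ {v K J} → J ≤ K → K ≤ v → (K ≡ v → J ≡ K) →
                  + complementSum v K J ≡ Spoly (+ v) (+ K) (+ J)
complementSum-ℤ {v} {K} {J} J≤K K≤v complete with ℕP.m≤n⇒m<n∨m≡n K≤v
... | inj₁ K<v = subst₂ (λ K′ v′ → + complementSum v′ K′ J ≡ Spoly (+ v′) (+ K′) (+ J))
                        a+J≡K a+J+r+1≡v (complementSum-quasi-ℤ (K ∸ J) J (v ∸ suc K))
  where a+J≡K : K ∸ J ℕ.+ J ≡ K
        a+J≡K = ℕP.m∸n+n≡m J≤K
        a+J+r+1≡v : K ∸ J ℕ.+ J ℕ.+ suc (v ∸ suc K) ≡ v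
        a+J+r+1≡v = trans (cong (ℕ._+ suc (v ∸ suc K)) a+J≡K) (trans (ℕP.+-suc K _) (ℕP.m+[n∸m]≡n K<v))
... | inj₂ refl with complete refl
...   | refl = trans (cong +_ (complementSum-complete K)) (sym (Spoly-complete (+ K)))

complementSum-at : ∀ {v l e₂} → 1 ≤ v → 1 ≤ l → l C 2 ≤ e₂ → e₂ ≤ suc l C 2 → e₂ ≤ v C 2 →
                   + complementSum v (qcK e₂) (qcJ e₂) ≡ Spoly (+ v) (+ l) (+ (suc l C 2) - + e₂)
complementSum-at {v} {l} {e₂} 1≤v 1≤l lo hi e₂≤V with ℕP.m≤n⇒m<n∨m≡n hi
... | inj₁ e₂< = begin
  + complementSum v (qcK e₂) (qcJ e₂)  ≡⟨ cong (λ K → + complementSum v K (suc K C 2 ∸ e₂)) K≡l ⟩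
  + complementSum v l j                ≡⟨ complementSum-ℤ (gap-bound lo) l≤v complete ⟩
  Spoly (+ v) (+ l) (+ j)              ≡⟨ cong (Spoly (+ v) (+ l)) (pos-∸ hi) ⟩
  Spoly (+ v) (+ l) (+ (suc l C 2) - + e₂) ∎
  where
  K≡l : qcK e₂ ≡ l
  K≡l = qcK-unique 1≤l lo e₂<
  j : ℕ
  j = suc l C 2 ∸ e₂
  l≤v : l ≤ v
  l≤v = C2-cancel-≤ 1≤v (ℕP.≤-trans lo e₂≤V)
  -- if l = v then T l ≤ e₂ ≤ T v forces e₂ = T l, so j = l
  complete : l ≡ v → j ≡ l
  complete l≡v = trans (cong (suc l C 2 ∸_) (ℕP.≤-antisym (subst (λ n → e₂ ≤ n C 2) (sym l≡v) e₂≤V) lo)) (C2-gap l)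
... | inj₂ refl = begin
  + complementSum v (qcK e₂) (qcJ e₂)  ≡⟨ cong₂ (λ K J → + complementSum v K J) (qcK-boundary l) (qcJ-boundary l) ⟩
  + complementSum v (suc l) (suc l)    ≡⟨ complementSum-ℤ ℕP.≤-refl (C2-cancel-≤ {suc l} 1≤v e₂≤V) (λ _ → refl) ⟩
  Spoly (+ v) (+ suc l) (+ suc l)      ≡⟨ Spoly-boundary (+ v) (+ l) (+ e₂) ⟩
  Spoly (+ v) (+ l) (+ e₂ - + e₂)      ∎

Sq-formula : ∀ v l e → 1 ≤ v → 1 ≤ l → e ℕ.+ l C 2 ≤ v C 2 → v C 2 ≤ e ℕ.+ suc l C 2 →
             + Sq v e ≡ Spoly (+ v) (+ l) (+ (suc l C 2) - (+ (v C 2) - + e))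
Sq-formula v l e 1≤v 1≤l lo hi = begin
  + Sq v e                                    ≡⟨ cong +_ (Sq-complementSum v e) ⟩
  + complementSum v (qcK e₂) (qcJ e₂)         ≡⟨ complementSum-at 1≤v 1≤l lo₂ hi₂ (ℕP.m∸n≤m (v C 2) e) ⟩
  Spoly (+ v) (+ l) (+ (suc l C 2) - + e₂)    ≡⟨ cong (λ x → Spoly (+ v) (+ l) (+ (suc l C 2) - x)) (pos-∸ e≤V) ⟩
  Spoly (+ v) (+ l) (+ (suc l C 2) - (+ (v C 2) - + e)) ∎
  where
  e₂ : ℕ
  e₂ = v C 2 ∸ e
  e≤V : e ≤ v C 2
  e≤V = ℕP.m+n≤o⇒m≤o e lo
  lo₂ : l C 2 ≤ e₂
  lo₂ = ℕP.m+n≤o⇒m≤o∸n (l C 2) (subst (_≤ v C 2) (ℕP.+-comm e (l C 2)) lo)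
  hi₂ : e₂ ≤ suc l C 2
  hi₂ = ℕP.m≤n+o⇒m∸n≤o (v C 2) e hi

Diff-formula : ∀ v k l e → 1 ≤ v → 1 ≤ k → 1 ≤ l → InInterval v k l e →
  Diff v e ≡ Spoly (+ v) (+ l) (+ (suc l C 2) - (+ (v C 2) - + e)) - Cpoly (+ k) (+ (suc k C 2) - + e)
Diff-formula v k l e 1≤v 1≤k 1≤l (k-lo , l-lo , k-hi , l-hi) =
  cong₂ _-_ (Sq-formula v l e 1≤v 1≤l l-hi l-lo) (Cq-formula v k e 1≤k k-lo k-hi)

-- 2·t - n(n-1), which vanishes exactly when t is the triangular number T n.
triangleDefect : ℤ → ℤ → ℤ
triangleDefect n t = + 2 * t - n * (n - + 1)

triangleDefect-C2 : ∀ {n} → 1 ≤ n → triangleDefect (+ n) (+ (n C 2)) ≡ + 0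
triangleDefect-C2 {suc n} _ = begin
  + 2 * + (suc n C 2) - + suc n * + n  ≡⟨ cong (_- + suc n * + n) twice ⟩
  + suc n * + n - + suc n * + n        ≡⟨ +-inverseʳ (+ suc n * + n) ⟩
  + 0                                  ∎
  where twice : + 2 * + (suc n C 2) ≡ + suc n * + n
        twice = trans (sym (pos-* 2 (suc n C 2))) (trans (cong +_ (two-C2 n)) (pos-* (suc n) n))

-- The algebraic heart: the quadratic terms of Diff cancel, and the linear
-- coefficient equals the slope up to multiples of the three triangle defects.
increment-identity : ∀ v k l tk tl V e e′ →
  + 4 * ((Spoly v l (tl - (V - e′)) - Cpoly k (tk - e′)) - (Spoly v l (tl - (V - e)) - Cpoly k (tk - e)))
  ≡ - (+ 1 - (+ 2 * k - + 3) ^ 2 - (+ 2 * l - + 3) ^ 2 + (+ 2 * v - + 5) ^ 2) * (e′ - e)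
    + + 4 * (e′ - e) * (triangleDefect (+ 1 + k) tk + triangleDefect (+ 1 + l) tl - triangleDefect v V)
increment-identity = expanded
  where
  expanded : ∀ v k l tk tl V e e′ →
    let sq : ℤ → ℤ
        sq x = x * (x * + 1)
        C : ℤ → ℤ → ℤ
        C k j = j * sq (k - + 1) + (k - j) * sq k + sq (k - j)
        S : ℤ → ℤ → ℤ → ℤ
        S v l j = (l - j) * sq (v - + 1 - l) + j * sq (v - l) + sq (v - + 1 - l + j) + (v - + 1 - l) * sq (v - + 1)
        δ : ℤ → ℤ → ℤ
        δ n t = + 2 * t - n * (n - + 1)
    in + 4 * ((S v l (tl - (V - e′)) - C k (tk - e′)) - (S v l (tl - (V - e)) - C k (tk - e)))
       ≡ - (+ 1 - sq (+ 2 * k - + 3) - sq (+ 2 * l - + 3) + sq (+ 2 * v - + 5)) * (e′ - e)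
         + + 4 * (e′ - e) * (δ (+ 1 + k) tk + δ (+ 1 + l) tl - δ v V)
  expanded = solve-∀

lemma10 : (v k l : ℕ) → 1 ≤ v → 1 ≤ k → 1 ≤ l →
          (e e′ : ℕ) → InInterval v k l e → InInterval v k l e′ →
          + 4 * (Diff v e′ - Diff v e)
            ≡ - (+ 1 - (+ 2 * + k - + 3) ^ 2 - (+ 2 * + l - + 3) ^ 2 ℤ.+ (+ 2 * + v - + 5) ^ 2)
                * (+ e′ - + e)
lemma10 v k l 1≤v 1≤k 1≤l e e′ e∈ e′∈ = begin
  + 4 * (Diff v e′ - Diff v e)
    ≡⟨ cong₂ (λ x y → + 4 * (x - y)) (Diff-formula v k l e′ 1≤v 1≤k 1≤l e′∈) (Diff-formula v k l e 1≤v 1≤k 1≤l e∈) ⟩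
  + 4 * ((Spoly (+ v) (+ l) (tl - (V - + e′)) - Cpoly (+ k) (tk - + e′))
         - (Spoly (+ v) (+ l) (tl - (V - + e)) - Cpoly (+ k) (tk - + e)))
    ≡⟨ increment-identity (+ v) (+ k) (+ l) tk tl V (+ e) (+ e′) ⟩
  slope * (+ e′ - + e) + + 4 * (+ e′ - + e) * (triangleDefect (+ suc k) tk + triangleDefect (+ suc l) tl - triangleDefect (+ v) V)
    ≡⟨ cong (λ d → slope * (+ e′ - + e) + + 4 * (+ e′ - + e) * d) defects-vanish ⟩
  slope * (+ e′ - + e) + + 4 * (+ e′ - + e) * + 0
    ≡⟨ drop-zero (slope * (+ e′ - + e)) (+ 4 * (+ e′ - + e)) ⟩
  slope * (+ e′ - + e) ∎
  where
  tk tl V slope : ℤ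
  tk = + (suc k C 2)
  tl = + (suc l C 2)
  V = + (v C 2)
  slope = - (+ 1 - (+ 2 * + k - + 3) ^ 2 - (+ 2 * + l - + 3) ^ 2 + (+ 2 * + v - + 5) ^ 2)
  defects-vanish : triangleDefect (+ suc k) tk + triangleDefect (+ suc l) tl - triangleDefect (+ v) V ≡ + 0
  defects-vanish = cong₂ _-_ (cong₂ _+_ (triangleDefect-C2 {suc k} (s≤s z≤n)) (triangleDefect-C2 {suc l} (s≤s z≤n))) (triangleDefect-C2 1≤v)
  drop-zero : ∀ x y → x + y * + 0 ≡ x
  drop-zero = solve-∀
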